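{- Let $(G,k)$ be an instance of Diamond-free Edge Deletion (or of $\{$Diamond, $K_t\}$-free Edge Deletion for fixed $t\geq 4$), and let $(G',k')$ be obtained by applying Phase 1 to $(G,k)$. Then: (i) every vertex and every edge of $G'$ is a core member of $G'$; (ii) $G'$ has connected neighborhood; (iii) $|E(G')|\leq |E(G)|$ and $|V(G')|\leq 2|E(G)|$.
   Context: A diamond is $K_4$ minus an edge. Diamond-free Edge Deletion asks, for $(G,k)$, whether some $F\subseteq E(G)$, $|F|\le k$, makes $G-F$ free of induced diamonds; the $\{$Diamond, $K_t\}$ version additionally requires $G-F$ to be $K_t$-free. Let $\mathcal{H}$ be $\{\text{diamond}\}$ (resp. $\{\text{diamond},K_t\}$). A vertex or edge is a core member of $G$ if it lies in a (not necessarily induced) subgraph of $G$ isomorphic to a member of $\mathcal{H}$. A vertex $v$ has connected neighborhood if $G[N(v)]$ is connected; a graph has connected neighborhood if all its vertices do. A non-matching is a set of pairwise vertex-disjoint non-edges. Rules: (Irrelevant edge) delete an edge that is not a core member. (Sunflower) if $e=\{x,y\}\in E(G)$ and $G[N(x)\cap N(y)]$ has a non-matching of size at least $k+1$, delete $e$ and decrease $k$ by 1. (Vertex-split) if $G[N(v)]$ has components with vertex sets $V_1,\dots,V_t$, $t>1$, add new vertices $v_1,\dots,v_t$ with $N(v_i)=V_i$ and delete $v$. (Irrelevant component) delete any connected component of $G$ containing no induced member of $\mathcal{H}$. Phase 1: apply these four rules exhaustively. -}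

module Defs where

open import Data.Nat using (ℕ; zero; suc; _+_; _*_; _≤_; _<ᵇ_)
open import Data.Integer using (ℤ; +_; _-_; _≥_) renaming (_+_ to _+ℤ_)
open import Data.Fin using (Fin; zero; suc; toℕ; _≟_)
open import Data.Bool using (Bool; true; false; _∧_; _∨_; not; if_then_else_)
open import Data.Bool.Properties using (∧-comm; ∨-comm)
open import Data.Product using (Σ; ∃; ∃-syntax; _×_; _,_)
open import Data.Sum using (_⊎_)
open import Data.Empty using (⊥)
open import Data.Unit using (⊤)
open import Relation.Nullary using (¬_)
open import Relation.Nullary.Decidable using (⌊_⌋)
open import Relation.Binary.PropositionalEquality using (_≡_; _≢_; refl; cong₂; trans)
open import Relation.Binary.Construct.Closure.ReflexiveTransitive using (Star)

record Graph : Set where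
  field
    n     : ℕ
    adj   : Fin n → Fin n → Bool
    sym   : ∀ u v → adj u v ≡ adj v u
    irref : ∀ v → adj v v ≡ false
open Graph public

Edge : (G : Graph) → Fin (n G) → Fin (n G) → Set
Edge G u v = adj G u v ≡ true

count : ∀ m → (Fin m → Bool) → ℕ
count zero    p = 0
count (suc m) p = (if p zero then 1 else 0) + count m (λ i → p (suc i))

sumFin : ∀ m → (Fin m → ℕ) → ℕ
sumFin zero    f = 0
sumFin (suc m) f = f zero + sumFin m (λ i → f (suc i))

edges : Graph → ℕ
edges G = sumFin (n G) (λ i → count (n G) (λ j → adj G i j ∧ (toℕ i <ᵇ toℕ j)))

data Family : Set where
  diamondOnly : Family
  diamondKt   : (t : ℕ) → 4 ≤ t → Family

Distinct4 : ∀ {m} → Fin m → Fin m → Fin m → Fin m → Set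
Distinct4 a b c d = a ≢ b × a ≢ c × a ≢ d × b ≢ c × b ≢ d × c ≢ d

-- (not necessarily induced) diamond subgraph on a,b,c,d:
-- K4 on {a,b,c,d} minus the pair {c,d}
DiamondSub : (G : Graph) → (a b c d : Fin (n G)) → Set
DiamondSub G a b c d =
  Distinct4 a b c d × Edge G a b × Edge G a c × Edge G a d × Edge G b c × Edge G b d

InducedDiamond : (G : Graph) → (a b c d : Fin (n G)) → Set
InducedDiamond G a b c d = DiamondSub G a b c d × adj G c d ≡ false

-- a (not necessarily induced, equivalently induced) K_t, given by an injective labelling
Clique : (G : Graph) → (t : ℕ) → (Fin t → Fin (n G)) → Set
Clique G t f = ∀ i j → i ≢ j → Edge G (f i) (f j)

In4 : ∀ {m} → Fin m → Fin m → Fin m → Fin m → Fin m → Set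
In4 x a b c d = x ≡ a ⊎ x ≡ b ⊎ x ≡ c ⊎ x ≡ d

CliqueCoreV : Family → (G : Graph) → Fin (n G) → Set
CliqueCoreV diamondOnly     G x = ⊥
CliqueCoreV (diamondKt t _) G x =
  Σ (Fin t → Fin (n G)) λ f → Clique G t f × ∃[ i ] f i ≡ x

CoreVertex : Family → (G : Graph) → Fin (n G) → Set
CoreVertex h G x =
  (∃[ a ] ∃[ b ] ∃[ c ] ∃[ d ] DiamondSub G a b c d × In4 x a b c d)
  ⊎ CliqueCoreV h G x

CliqueCoreE : Family → (G : Graph) → Fin (n G) → Fin (n G) → Set
CliqueCoreE diamondOnly     G x y = ⊥
CliqueCoreE (diamondKt t _) G x y =
  Σ (Fin t → Fin (n G)) λ f → Clique G t f × ∃[ i ] ∃[ j ] i ≢ j × f i ≡ x × f j ≡ y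

CoreEdge : Family → (G : Graph) → Fin (n G) → Fin (n G) → Set
CoreEdge h G x y =
  (∃[ a ] ∃[ b ] ∃[ c ] ∃[ d ] DiamondSub G a b c d × In4 x a b c d × In4 y a b c d
      × x ≢ y × ¬ ((x ≡ c × y ≡ d) ⊎ (x ≡ d × y ≡ c)))
  ⊎ CliqueCoreE h G x y

CliqueIn : Family → (G : Graph) → (Fin (n G) → Set) → Set
CliqueIn diamondOnly     G S = ⊥
CliqueIn (diamondKt t _) G S =
  Σ (Fin t → Fin (n G)) λ f → Clique G t f × (∀ i → S (f i))

InducedMemberIn : Family → (G : Graph) → (Fin (n G) → Set) → Set
InducedMemberIn h G S =
  (∃[ a ] ∃[ b ] ∃[ c ] ∃[ d ] InducedDiamond G a b c d × S a × S b × S c × S d)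
  ⊎ CliqueIn h G S

N : (G : Graph) → Fin (n G) → Fin (n G) → Set
N G v u = Edge G v u

data ReachIn (G : Graph) (P : Fin (n G) → Set) (u : Fin (n G)) : Fin (n G) → Set where
  here : P u → ReachIn G P u u
  step : ∀ {v w} → ReachIn G P u v → Edge G v w → P w → ReachIn G P u w

Reach : (G : Graph) → Fin (n G) → Fin (n G) → Set
Reach G = ReachIn G (λ _ → ⊤)

ConnectedNbhdAt : (G : Graph) → Fin (n G) → Set
ConnectedNbhdAt G v = ∀ a b → N G v a → N G v b → ReachIn G (N G v) a b

ConnectedNbhd : Graph → Set
ConnectedNbhd G = ∀ v → ConnectedNbhdAt G v

isPair : ∀ {m} → Fin m → Fin m → Fin m → Fin m → Bool
isPair x y u v = (⌊ u ≟ x ⌋ ∧ ⌊ v ≟ y ⌋) ∨ (⌊ u ≟ y ⌋ ∧ ⌊ v ≟ x ⌋)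

isPair-sym : ∀ {m} (x y u v : Fin m) → isPair x y u v ≡ isPair x y v u
isPair-sym x y u v =
  trans (cong₂ _∨_ (∧-comm ⌊ u ≟ x ⌋ ⌊ v ≟ y ⌋) (∧-comm ⌊ u ≟ y ⌋ ⌊ v ≟ x ⌋))
        (∨-comm (⌊ v ≟ y ⌋ ∧ ⌊ u ≟ x ⌋) (⌊ v ≟ x ⌋ ∧ ⌊ u ≟ y ⌋))

removeEdge : (G : Graph) → Fin (n G) → Fin (n G) → Graph
removeEdge G x y = record
  { n     = n G
  ; adj   = λ u v → adj G u v ∧ not (isPair x y u v)
  ; sym   = λ u v → cong₂ (λ p q → p ∧ not q) (sym G u v) (isPair-sym x y u v)
  ; irref = λ v → irr v
  }
  where
    irr : ∀ v → adj G v v ∧ not (isPair x y v v) ≡ false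
    irr v rewrite irref G v = refl

NonMatching : (G : Graph) → (Fin (n G) → Set) → ℕ → Set
NonMatching G S m =
  Σ (Fin m → Fin (n G)) λ p → Σ (Fin m → Fin (n G)) λ q →
    (∀ i → S (p i) × S (q i) × p i ≢ q i × adj G (p i) (q i) ≡ false)
    × (∀ i j → i ≢ j → p i ≢ p j × q i ≢ q j × p i ≢ q j)

CommonNbhd : (G : Graph) → Fin (n G) → Fin (n G) → Fin (n G) → Set
CommonNbhd G x y u = Edge G x u × Edge G y u

-- Vertex split: G' arises from G by splitting v; o maps vertices of G'
-- to vertices of G (the new vertices v_i are exactly those mapped to v).

record VertexSplit (G : Graph) (v : Fin (n G)) (G' : Graph) : Set where
  field
    o        : Fin (n G') → Fin (n G)
    o-inj    : ∀ a b → o a ≡ o b → o a ≢ v → a ≡ b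
    o-surj   : ∀ u → u ≢ v → ∃[ a ] o a ≡ u
    old-adj  : ∀ a b → o a ≢ v → o b ≢ v → adj G' a b ≡ adj G (o a) (o b)
    -- each new vertex v_i has as neighbourhood exactly one component V_i of G[N(v)]
    new-adj  : ∀ a → o a ≡ v → Σ (Fin (n G)) λ c → N G v c ×
                 (∀ b → o b ≢ v → (Edge G' a b → ReachIn G (N G v) c (o b))
                                  × (ReachIn G (N G v) c (o b) → Edge G' a b))
    new-new  : ∀ a b → o a ≡ v → o b ≡ v → adj G' a b ≡ false
    -- distinct new vertices correspond to distinct components
    new-dist : ∀ a a' b → o a ≡ v → o a' ≡ v → Edge G' a b → Edge G' a' b → a ≡ a'
    -- every component is represented
    new-cov  : ∀ c → N G v c → ∃[ a ] ∃[ b ] o a ≡ v × o b ≡ c × Edge G' a b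
    -- t > 1: G[N(v)] is disconnected
    disconn  : ∃[ c ] ∃[ d ] N G v c × N G v d × ¬ ReachIn G (N G v) c d

record DeleteComponent (G : Graph) (c : Fin (n G)) (G' : Graph) : Set where
  field
    o       : Fin (n G') → Fin (n G)
    o-inj   : ∀ a b → o a ≡ o b → a ≡ b
    o-out   : ∀ a → ¬ Reach G c (o a)
    o-surj  : ∀ u → ¬ Reach G c u → ∃[ a ] o a ≡ u
    o-adj   : ∀ a b → adj G' a b ≡ adj G (o a) (o b)

-- Phase 1 rules (k is an integer; the sunflower rule decreases it)

Instance : Set
Instance = Graph × ℤ

data Step (h : Family) : Instance → Instance → Set where
  irrelevantEdge : ∀ {G k} (x y : Fin (n G)) → Edge G x y → ¬ CoreEdge h G x y →
                   Step h (G , k) (removeEdge G x y , k)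
  sunflower      : ∀ {G k} (x y : Fin (n G)) → Edge G x y →
                   (m : ℕ) → + m ≥ k +ℤ + 1 → NonMatching G (CommonNbhd G x y) m →
                   Step h (G , k) (removeEdge G x y , k - + 1)
  vertexSplit    : ∀ {G k} (v : Fin (n G)) (G' : Graph) → VertexSplit G v G' →
                   Step h (G , k) (G' , k)
  irrelevantComp : ∀ {G k} (c : Fin (n G)) (G' : Graph) →
                   ¬ InducedMemberIn h G (Reach G c) → DeleteComponent G c G' →
                   Step h (G , k) (G' , k)

Irreducible : Family → Instance → Set
Irreducible h I = ∀ J → ¬ Step h I J

Phase1 : Family → Instance → Instance → Set
Phase1 h I J = Star (Step h) I J × Irreducible h J

-- Phase 1 stops only when no rule applies, and each claim is the failure of one rule. An edge
-- outside every member of H would be an irrelevant edge; this is decidable because in a K_t with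
-- t ≥ 4 every edge already lies in a diamond. An isolated vertex is a component without members
-- of H, so every vertex has a neighbour and lies on a core edge. A vertex with disconnected
-- neighbourhood could be split; deciding this needs reachability inside G[N(v)], computed as the
-- fixed point of an extensive operator on vertex sets. For the counts, every rule comes with a
-- map from new to old vertices sending ordered edges injectively to ordered edges, so |E| never
-- grows; as no vertex of G' is isolated, |V(G')| ≤ Σ deg = 2|E(G')| ≤ 2|E(G)|.

module Submission where

open import Defs hiding (sym)
open Graph using () renaming (sym to adj-sym)
open import Data.Bool using (Bool; true; false; _∧_; _∨_; not; if_then_else_; T)
open import Data.Bool.Properties using (¬-not) renaming (_≟_ to _≟ᵇ_)
open import Data.Empty using (⊥-elim)
open import Data.Fin
  using (Fin; zero; suc; toℕ; _≟_; punchIn; punchOut; splitAt; join; _↑ˡ_; _↑ʳ_; combine; remQuot)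
open import Data.Fin.Patterns using (0F; 1F; 2F; 3F)
open import Data.Fin.Properties
  using (suc-injective; toℕ-injective; all?; any?; ¬∀⟶∃¬; injective⇒≤; splitAt-join; join-splitAt;
         punchIn-injective; punchInᵢ≢i; punchIn-punchOut;
         combine-injectiveˡ; combine-injectiveʳ; combine-remQuot; remQuot-combine)
open import Data.Integer using (ℤ; +_)
open import Data.Nat using (ℕ; zero; suc; _+_; _*_; _≤_; _<_; z≤n; s≤s; _<ᵇ_; _≤?_)
open import Data.Nat.Properties
  using (+-0-commutativeMonoid; ≤-refl; ≤-trans; ≤-antisym; 1+n≰n; m≤n+m; <-asym; <-cmp; <ᵇ⇒<; <⇒<ᵇ;
         +-assoc; +-identityʳ; +-mono-≤; +-mono-<-≤; +-mono-≤-<; *-cancelˡ-≤; *-monoʳ-≤)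
open import Data.Product using (Σ; ∃-syntax; _×_; _,_; proj₁; proj₂; uncurry)
open import Data.Sum using (_⊎_; inj₁; inj₂)
open import Function using (_∘_; case_of_)
open import Relation.Binary using (tri<; tri≈; tri>)
open import Relation.Binary.Construct.Closure.ReflexiveTransitive using (Star; ε; _◅_)
open import Relation.Nullary using (¬_; Dec; yes; no; does)
open import Relation.Nullary.Decidable using (dec-true; ¬?; _×-dec_; _⊎-dec_; _→-dec_)
open import Relation.Binary.PropositionalEquality
  using (_≡_; _≢_; ≢-sym; refl; sym; trans; cong; cong₂; subst; subst₂; module ≡-Reasoning)
open import Algebra.Properties.CommutativeMonoid.Sum +-0-commutativeMonoid
  using (sum; sum-cong-≗; ∑-distrib-+; ∑-comm)

∧-≡-true : ∀ {a b} → a ∧ b ≡ true → a ≡ true × b ≡ true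
∧-≡-true {true} {true} _ = refl , refl

∨-≡-true : ∀ {a b} → a ∨ b ≡ true → a ≡ true ⊎ b ≡ true
∨-≡-true {true}  _  = inj₁ refl
∨-≡-true {false} ab = inj₂ ab

does-true : ∀ {A : Set} (a? : Dec A) → does a? ≡ true → A
does-true (yes a) _ = a

indicator : Bool → ℕ
indicator b = if b then 1 else 0

_⊆ᵇ_ : ∀ {m} → (Fin m → Bool) → (Fin m → Bool) → Set
p ⊆ᵇ q = ∀ i → p i ≡ true → q i ≡ true

sumFin≡sum : ∀ m (f : Fin m → ℕ) → sumFin m f ≡ sum f
sumFin≡sum zero    f = refl
sumFin≡sum (suc m) f = cong (_+_ (f zero)) (sumFin≡sum m (f ∘ suc))

count≡sum : ∀ m (p : Fin m → Bool) → count m p ≡ sum (indicator ∘ p)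
count≡sum zero    p = refl
count≡sum (suc m) p = cong (_+_ (indicator (p zero))) (count≡sum m (p ∘ suc))

count-true : ∀ m → count m (λ _ → true) ≡ m
count-true zero    = refl
count-true (suc m) = cong suc (count-true m)

count-pos : ∀ m (p : Fin m → Bool) i → p i ≡ true → 1 ≤ count m p
count-pos (suc m) p zero    pi rewrite pi = s≤s z≤n
count-pos (suc m) p (suc i) pi = ≤-trans (count-pos m (p ∘ suc) i pi) (m≤n+m _ _)

sum-mono-≤ : ∀ {m} {f g : Fin m → ℕ} → (∀ i → f i ≤ g i) → sum f ≤ sum g
sum-mono-≤ {zero}  f≤g = z≤n
sum-mono-≤ {suc m} f≤g = +-mono-≤ (f≤g zero) (sum-mono-≤ (f≤g ∘ suc))

sum-mono-< : ∀ {m} {f g : Fin m → ℕ} → (∀ i → f i ≤ g i) → ∀ j → f j < g j → sum f < sum g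
sum-mono-< f≤g zero    fj<gj = +-mono-<-≤ fj<gj (sum-mono-≤ (f≤g ∘ suc))
sum-mono-< f≤g (suc j) fj<gj = +-mono-≤-< (f≤g zero) (sum-mono-< (f≤g ∘ suc) j fj<gj)

indicator-mono : ∀ {b c} → (b ≡ true → c ≡ true) → indicator b ≤ indicator c
indicator-mono {false} _ = z≤n
indicator-mono {true}  b⇒c rewrite b⇒c refl = ≤-refl

count-mono : ∀ m {p q : Fin m → Bool} → p ⊆ᵇ q → count m p ≤ count m q
count-mono m {p} {q} p⊆q = subst₂ _≤_ (sym (count≡sum m p)) (sym (count≡sum m q))
  (sum-mono-≤ (λ i → indicator-mono (p⊆q i)))

count-< : ∀ m {p q : Fin m → Bool} → p ⊆ᵇ q → ∀ j → p j ≡ false → q j ≡ true →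
          count m p < count m q
count-< m {p} {q} p⊆q j pj qj = subst₂ _<_ (sym (count≡sum m p)) (sym (count≡sum m q))
  (sum-mono-< (λ i → indicator-mono (p⊆q i)) j
    (subst₂ (λ b c → indicator b < indicator c) (sym pj) (sym qj) ≤-refl))

count≤ : ∀ m (p : Fin m → Bool) → count m p ≤ m
count≤ m p = subst (count m p ≤_) (count-true m) (count-mono m (λ _ _ → refl))

count-split : ∀ m (p q : Fin m → Bool) →
              count m p ≡ count m (λ j → p j ∧ q j) + count m (λ j → p j ∧ not (q j))
count-split m p q = begin
  count m p                                          ≡⟨ count≡sum m p ⟩
  sum (indicator ∘ p)                                ≡⟨ sum-cong-≗ (λ j → indicator-split (p j) (q j)) ⟩
  sum (λ j → indicator (p j ∧ q j) + indicator (p j ∧ not (q j)))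
                                                     ≡⟨ ∑-distrib-+ (indicator ∘ p∧q) (indicator ∘ p∧¬q) ⟩
  sum (indicator ∘ p∧q) + sum (indicator ∘ p∧¬q)    ≡⟨ sym (cong₂ _+_ (count≡sum m p∧q) (count≡sum m p∧¬q)) ⟩
  count m (λ j → p j ∧ q j) + count m (λ j → p j ∧ not (q j)) ∎
  where
  open ≡-Reasoning
  p∧q p∧¬q : Fin m → Bool
  p∧q  j = p j ∧ q j
  p∧¬q j = p j ∧ not (q j)
  indicator-split : ∀ b c → indicator b ≡ indicator (b ∧ c) + indicator (b ∧ not c)
  indicator-split false _     = refl
  indicator-split true  false = refl
  indicator-split true  true  = refl

enumerate : ∀ m (p : Fin m → Bool) → Fin (count m p) → Fin m
enumerate (suc m) p j with p zero
enumerate (suc m) p zero    | true  = zero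
enumerate (suc m) p (suc j) | true  = suc (enumerate m (p ∘ suc) j)
enumerate (suc m) p j       | false = suc (enumerate m (p ∘ suc) j)

enumerate-sound : ∀ m (p : Fin m → Bool) j → p (enumerate m p j) ≡ true
enumerate-sound (suc m) p j with p zero in p0
enumerate-sound (suc m) p zero    | true  = p0
enumerate-sound (suc m) p (suc j) | true  = enumerate-sound m (p ∘ suc) j
enumerate-sound (suc m) p j       | false = enumerate-sound m (p ∘ suc) j

enumerate-injective : ∀ m (p : Fin m → Bool) {j j'} → enumerate m p j ≡ enumerate m p j' → j ≡ j'
enumerate-injective (suc m) p {j} {j'} eq with p zero
enumerate-injective (suc m) p {zero}  {zero}   eq | true = refl
enumerate-injective (suc m) p {suc j} {suc j'} eq | true =
  cong suc (enumerate-injective m (p ∘ suc) (suc-injective eq))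
enumerate-injective (suc m) p {j}     {j'}     eq | false =
  enumerate-injective m (p ∘ suc) (suc-injective eq)

position : ∀ m (p : Fin m → Bool) i → p i ≡ true → Fin (count m p)
position (suc m) p zero    pi with p zero
... | true  = zero
position (suc m) p (suc i) pi with p zero
... | true  = suc (position m (p ∘ suc) i pi)
... | false = position m (p ∘ suc) i pi

enumerate-position : ∀ m (p : Fin m → Bool) i (pi : p i ≡ true) → enumerate m p (position m p i pi) ≡ i
enumerate-position (suc m) p zero    pi with p zero
... | true  = refl
enumerate-position (suc m) p (suc i) pi with p zero
... | true  = cong suc (enumerate-position m (p ∘ suc) i pi)
... | false = cong suc (enumerate-position m (p ∘ suc) i pi)

count-mono-injective : ∀ {m k} {p : Fin m → Bool} {q : Fin k → Bool} (o : Fin m → Fin k) →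
                       (∀ i → p i ≡ true → q (o i) ≡ true) →
                       (∀ i j → p i ≡ true → p j ≡ true → o i ≡ o j → i ≡ j) →
                       count m p ≤ count k q
count-mono-injective {m} {k} {p} {q} o o-pres o-inj = injective⇒≤ {f = index} index-injective
  where
  hit : ∀ j → q (o (enumerate m p j)) ≡ true
  hit j = o-pres _ (enumerate-sound m p j)
  index : Fin (count m p) → Fin (count k q)
  index j = position k q (o (enumerate m p j)) (hit j)
  index-injective : ∀ {j j'} → index j ≡ index j' → j ≡ j'
  index-injective {j} {j'} eq = enumerate-injective m p
    (o-inj _ _ (enumerate-sound m p j) (enumerate-sound m p j')
      (trans (sym (enumerate-position k q _ (hit j)))
        (trans (cong (enumerate k q) eq) (enumerate-position k q _ (hit j')))))

sum-↑ : ∀ a {b} (f : Fin (a + b) → ℕ) → sum f ≡ sum (f ∘ (_↑ˡ b)) + sum (f ∘ (a ↑ʳ_))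
sum-↑ zero    f = refl
sum-↑ (suc a) f = trans (cong (_+_ (f zero)) (sum-↑ a (f ∘ suc))) (sym (+-assoc (f zero) _ _))

sum-combine : ∀ m {k} (f : Fin (m * k) → ℕ) → sum f ≡ sum (λ i → sum (λ j → f (combine {m} {k} i j)))
sum-combine zero        f = refl
sum-combine (suc m) {k} f =
  trans (sum-↑ k f) (cong (_+_ (sum (f ∘ (_↑ˡ (m * k))))) (sum-combine m (f ∘ (k ↑ʳ_))))

countPairs : ∀ m → (Fin m → Fin m → Bool) → ℕ
countPairs m R = sum {m} (λ i → count m (R i))

unpair : ∀ {m} → Fin (m * m) → Fin m × Fin m
unpair {m} = remQuot m

countPairs≡count : ∀ m (R : Fin m → Fin m → Bool) → countPairs m R ≡ count (m * m) (uncurry R ∘ unpair)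
countPairs≡count m R = begin
  sum {m} (λ i → count m (R i))
    ≡⟨ sum-cong-≗ (λ i → count≡sum m (R i)) ⟩
  sum {m} (λ i → sum {m} (λ j → indicator (R i j)))
    ≡⟨ sum-cong-≗ (λ i → sum-cong-≗ (λ j → cong (indicator ∘ uncurry R) (sym (remQuot-combine i j)))) ⟩
  sum {m} (λ i → sum {m} (λ j → indicator (uncurry R (unpair (combine i j)))))
    ≡⟨ sym (sum-combine m (indicator ∘ uncurry R ∘ unpair)) ⟩
  sum (indicator ∘ uncurry R ∘ unpair)
    ≡⟨ sym (count≡sum (m * m) (uncurry R ∘ unpair)) ⟩
  count (m * m) (uncurry R ∘ unpair) ∎
  where open ≡-Reasoning

countPairs-mono-injective :
  ∀ {m k} {R : Fin m → Fin m → Bool} {S : Fin k → Fin k → Bool} (o : Fin m → Fin k) →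
  (∀ i j → R i j ≡ true → S (o i) (o j) ≡ true) →
  (∀ i j i' j' → R i j ≡ true → R i' j' ≡ true → o i ≡ o i' → o j ≡ o j' → i ≡ i' × j ≡ j') →
  countPairs m R ≤ countPairs k S
countPairs-mono-injective {m} {k} {R} {S} o o-pres o-inj =
  subst₂ _≤_ (sym (countPairs≡count m R)) (sym (countPairs≡count k S))
    (count-mono-injective oo oo-pres oo-inj)
  where
  oo : Fin (m * m) → Fin (k * k)
  oo x = combine (o (proj₁ (unpair x))) (o (proj₂ (unpair x)))
  oo-pres : ∀ x → uncurry R (unpair x) ≡ true → uncurry S (unpair (oo x)) ≡ true
  oo-pres x r = subst (λ ij → uncurry S ij ≡ true) (sym (remQuot-combine _ _)) (o-pres _ _ r)
  oo-inj : ∀ x y → uncurry R (unpair x) ≡ true → uncurry R (unpair y) ≡ true → oo x ≡ oo y → x ≡ y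
  oo-inj x y rx ry eq
    with i≡i' , j≡j' ← o-inj _ _ _ _ rx ry (combine-injectiveˡ {k} _ _ _ _ eq) (combine-injectiveʳ {k} _ _ _ _ eq) =
    trans (sym (combine-remQuot {m} m x)) (trans (cong₂ combine i≡i' j≡j') (combine-remQuot {m} m y))

least : ∀ {k} {Q : Fin k → Set} → (∀ i → Dec (Q i)) → ∀ {c} → Q c →
        ∃[ r ] Q r × (∀ d → Q d → toℕ r ≤ toℕ d)
least {suc k} Q? {c} Qc with Q? zero
... | yes Q0 = zero , Q0 , λ _ _ → z≤n
least {suc k} Q? {zero}  Q0 | no ¬Q0 = ⊥-elim (¬Q0 Q0)
least {suc k} Q? {suc c} Qc | no ¬Q0 with r , Qr , r-least ← least (Q? ∘ suc) Qc =
  suc r , Qr , λ { zero Q0 → ⊥-elim (¬Q0 Q0) ; (suc d) Qd → s≤s (r-least d Qd) }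

degreeSum : Graph → ℕ
degreeSum G = countPairs (n G) (adj G)

edge-irreflexive : (G : Graph) {u v : Fin (n G)} → Edge G u v → u ≢ v
edge-irreflexive G {u} uv refl with () ← trans (sym uv) (irref G u)

<ᵇ-flip : ∀ {a b} → a ≢ b → not (a <ᵇ b) ≡ (b <ᵇ a)
<ᵇ-flip {a} {b} a≢b with a <ᵇ b in ab | b <ᵇ a in ba
... | true  | false = refl
... | false | true  = refl
... | true  | true  = ⊥-elim (<-asym (<ᵇ⇒< a b (subst T (sym ab) _)) (<ᵇ⇒< b a (subst T (sym ba) _)))
... | false | false with <-cmp a b
...   | tri< a<b _ _ = ⊥-elim (subst T ab (<⇒<ᵇ a<b))
...   | tri≈ _ a≡b _ = ⊥-elim (a≢b a≡b)
...   | tri> _ _ b<a = ⊥-elim (subst T ba (<⇒<ᵇ b<a))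

degreeSum≡2*edges : (G : Graph) → degreeSum G ≡ 2 * edges G
degreeSum≡2*edges G = begin
  sum (λ i → count m (adj G i))  ≡⟨ sum-cong-≗ (λ i → count-split m (adj G i) (forward i)) ⟩
  sum (λ i → up i + down i)      ≡⟨ ∑-distrib-+ up down ⟩
  sum up + sum down              ≡⟨ cong₂ _+_ (sym (sumFin≡sum m up)) sum-down≡edges ⟩
  edges G + edges G              ≡⟨ cong (_+_ (edges G)) (sym (+-identityʳ (edges G))) ⟩
  2 * edges G                    ∎
  where
  open ≡-Reasoning
  m : ℕ
  m = n G
  forward : Fin m → Fin m → Bool
  forward i j = toℕ i <ᵇ toℕ j
  up down : Fin m → ℕ
  up   i = count m (λ j → adj G i j ∧ forward i j)
  down i = count m (λ j → adj G i j ∧ not (forward i j))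
  reverse : ∀ i j → adj G i j ∧ not (forward i j) ≡ adj G j i ∧ forward j i
  reverse i j with adj G i j in ij
  ... | false = sym (cong (_∧ forward j i) (trans (adj-sym G j i) ij))
  ... | true  rewrite trans (adj-sym G j i) ij = <ᵇ-flip (edge-irreflexive G ij ∘ toℕ-injective)
  sum-down≡edges : sum down ≡ edges G
  sum-down≡edges = begin
    sum down
      ≡⟨ sum-cong-≗ (λ i → trans (count≡sum m _) (sum-cong-≗ (λ j → cong indicator (reverse i j)))) ⟩
    sum (λ i → sum (λ j → indicator (adj G j i ∧ forward j i)))
      ≡⟨ ∑-comm (λ i j → indicator (adj G j i ∧ forward j i)) ⟩
    sum (λ j → sum (λ i → indicator (adj G j i ∧ forward j i)))
      ≡⟨ sym (sum-cong-≗ (λ j → count≡sum m (λ i → adj G j i ∧ forward j i))) ⟩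
    sum (λ j → count m (λ i → adj G j i ∧ forward j i))
      ≡⟨ sym (sumFin≡sum m _) ⟩
    edges G ∎

n≤degreeSum : (G : Graph) → (∀ i → ∃[ j ] Edge G i j) → n G ≤ degreeSum G
n≤degreeSum G has-neighbour =
  subst (_≤ degreeSum G) (trans (sym (count≡sum (n G) (λ _ → true))) (count-true (n G)))
    (sum-mono-≤ (λ i → count-pos (n G) (adj G i) (proj₁ (has-neighbour i)) (proj₂ (has-neighbour i))))

record EdgeEmbedding (G' G : Graph) : Set where
  field
    map       : Fin (n G') → Fin (n G)
    preserve  : ∀ a b → Edge G' a b → Edge G (map a) (map b)
    injective : ∀ a b a' b' → Edge G' a b → Edge G' a' b' →
                map a ≡ map a' → map b ≡ map b' → a ≡ a' × b ≡ b'

edges-mono : ∀ {G' G} → EdgeEmbedding G' G → edges G' ≤ edges G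
edges-mono {G'} {G} φ = *-cancelˡ-≤ 2 (subst₂ _≤_ (degreeSum≡2*edges G') (degreeSum≡2*edges G)
  (countPairs-mono-injective map preserve injective))
  where open EdgeEmbedding φ

module _ (G : Graph) {P : Fin (n G) → Set} where

  reach-target : ∀ {u w} → ReachIn G P u w → P w
  reach-target (here pw)     = pw
  reach-target (step _ _ pw) = pw

  reach-trans : ∀ {u v w} → ReachIn G P u v → ReachIn G P v w → ReachIn G P u w
  reach-trans r (here _)       = r
  reach-trans r (step r' e pw) = step (reach-trans r r') e pw

  reach-prepend : ∀ {u v w} → Edge G w u → P w → ReachIn G P u v → ReachIn G P w v
  reach-prepend e pw (here pu)       = step (here pw) e pu
  reach-prepend e pw (step r e' pv) = step (reach-prepend e pw r) e' pv

  reach-sym : ∀ {u w} → ReachIn G P u w → ReachIn G P w u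
  reach-sym (here pu) = here pu
  reach-sym (step {v} {w} r e pw) = reach-prepend (trans (adj-sym G w v) e) pw (reach-sym r)

module Iteration {m} (F : (Fin m → Bool) → Fin m → Bool) (F-extensive : ∀ R → R ⊆ᵇ F R) where

  iterate : ℕ → (Fin m → Bool) → Fin m → Bool
  iterate zero    R = R
  iterate (suc k) R = F (iterate k R)

  IsFixedPoint : (Fin m → Bool) → Set
  IsFixedPoint R = ∀ u → F R u ≡ R u

  iterate-extensive : ∀ k R → R ⊆ᵇ iterate k R
  iterate-extensive zero    R u Ru = Ru
  iterate-extensive (suc k) R u Ru = F-extensive _ u (iterate-extensive k R u Ru)

  -- Each iteration that is not yet a fixed point adds an element, and only m can be added.
  fixedOrGrowing : ∀ R k → (∃[ j ] IsFixedPoint (iterate j R)) ⊎ (k ≤ count m (iterate k R))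
  fixedOrGrowing R zero = inj₂ z≤n
  fixedOrGrowing R (suc k) with fixedOrGrowing R k
  ... | inj₁ fp  = inj₁ fp
  ... | inj₂ k≤ with all? (λ u → F (iterate k R) u ≟ᵇ iterate k R u)
  ...   | yes fp = inj₁ (k , fp)
  ...   | no ¬fp with u , Fu≢u ← ¬∀⟶∃¬ m _ (λ u → F (iterate k R) u ≟ᵇ iterate k R u) ¬fp =
    let Ru≡false , FRu≡true = grows (F-extensive _ u) Fu≢u
    in inj₂ (≤-trans (s≤s k≤) (count-< m (F-extensive _) u Ru≡false FRu≡true))
    where
    grows : ∀ {b c} → (b ≡ true → c ≡ true) → c ≢ b → b ≡ false × c ≡ true
    grows {false} {true}  _   _   = refl , refl
    grows {false} {false} _   c≢b = ⊥-elim (c≢b refl)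
    grows {true}  b⇒c         c≢b = ⊥-elim (c≢b (b⇒c refl))

  fixedPoint : ∀ R → ∃[ k ] IsFixedPoint (iterate k R)
  fixedPoint R with fixedOrGrowing R (suc m)
  ... | inj₁ fp          = fp
  ... | inj₂ suc-m≤count = ⊥-elim (1+n≰n (≤-trans suc-m≤count (count≤ m _)))

module _ (G : Graph) (p : Fin (n G) → Bool) (c : Fin (n G)) where
  private
    Inside : Fin (n G) → Set
    Inside u = p u ≡ true

    adjacentFrom? : (R : Fin (n G) → Bool) (u : Fin (n G)) → Dec (∃[ w ] R w ∧ adj G w u ≡ true)
    adjacentFrom? R u = any? (λ w → R w ∧ adj G w u ≟ᵇ true)

    extend : (Fin (n G) → Bool) → Fin (n G) → Bool
    extend R u = R u ∨ (p u ∧ does (adjacentFrom? R u))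

    extend-extensive : ∀ R → R ⊆ᵇ extend R
    extend-extensive R u Ru rewrite Ru = refl

    seed : Fin (n G) → Bool
    seed u = does (u ≟ c) ∧ p c

    open Iteration extend extend-extensive

    iterate-sound : ∀ k u → iterate k seed u ≡ true → ReachIn G Inside c u
    iterate-sound zero u seed-u with ∧-≡-true {does (u ≟ c)} seed-u
    ... | u≟c , pc with refl ← does-true (u ≟ c) u≟c = here pc
    iterate-sound (suc k) u Ru with ∨-≡-true {iterate k seed u} Ru
    ... | inj₁ Ru′ = iterate-sound k u Ru′
    ... | inj₂ pu∧adjacent with pu , adjacent ← ∧-≡-true {p u} pu∧adjacent
                            with w , Rw∧wu ← does-true (adjacentFrom? _ u) adjacent
                            with Rw , wu ← ∧-≡-true {iterate k seed w} Rw∧wu =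
      step (iterate-sound k w Rw) wu pu

    stages : ℕ
    stages = proj₁ (fixedPoint seed)

    closure : Fin (n G) → Bool
    closure = iterate stages seed

    closure-complete : ∀ u → ReachIn G Inside c u → closure u ≡ true
    closure-complete u (here pc) =
      iterate-extensive stages seed c (trans (cong (_∧ p c) (dec-true (c ≟ c) refl)) pc)
    closure-complete u (step {v} r vu pu) = trans (sym (proj₂ (fixedPoint seed) u)) extend-closure-u
      where
      extend-closure-u : extend closure u ≡ true
      extend-closure-u with closure u
      ... | true  = refl
      ... | false rewrite pu = dec-true (adjacentFrom? closure u)
                                 (v , trans (cong (_∧ adj G v u) (closure-complete v r)) vu)

  reachIn? : ∀ u → Dec (ReachIn G (λ w → p w ≡ true) c u)
  reachIn? u with closure u in closure-u
  ... | true  = yes (iterate-sound stages u closure-u)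
  ... | false = no (λ r → case trans (sym (closure-complete u r)) closure-u of λ ())

DiamondCoreEdge : (G : Graph) → Fin (n G) → Fin (n G) → Set
DiamondCoreEdge G x y =
  ∃[ a ] ∃[ b ] ∃[ c ] ∃[ d ] DiamondSub G a b c d × In4 x a b c d × In4 y a b c d
    × x ≢ y × ¬ ((x ≡ c × y ≡ d) ⊎ (x ≡ d × y ≡ c))

diamondCoreEdge? : (G : Graph) (x y : Fin (n G)) → Dec (DiamondCoreEdge G x y)
diamondCoreEdge? G x y = any? λ a → any? λ b → any? λ c → any? λ d →
  ((¬? (a ≟ b) ×-dec ¬? (a ≟ c) ×-dec ¬? (a ≟ d) ×-dec ¬? (b ≟ c) ×-dec ¬? (b ≟ d) ×-dec ¬? (c ≟ d))
    ×-dec edge? a b ×-dec edge? a c ×-dec edge? a d ×-dec edge? b c ×-dec edge? b d)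
  ×-dec (x ≟ a ⊎-dec x ≟ b ⊎-dec x ≟ c ⊎-dec x ≟ d)
  ×-dec (y ≟ a ⊎-dec y ≟ b ⊎-dec y ≟ c ⊎-dec y ≟ d)
  ×-dec ¬? (x ≟ y)
  ×-dec ¬? ((x ≟ c ×-dec y ≟ d) ⊎-dec (x ≟ d ×-dec y ≟ c))
  where
  edge? : ∀ u w → Dec (Edge G u w)
  edge? u w = adj G u w ≟ᵇ true

twoOthers : ∀ {t} (i j : Fin (4 + t)) →
            ∃[ k ] ∃[ l ] k ≢ i × k ≢ j × l ≢ i × l ≢ j × k ≢ l
twoOthers 0F                  0F                  = 2F , 3F , (λ ()) , (λ ()) , (λ ()) , (λ ()) , (λ ())
twoOthers 0F                  1F                  = 2F , 3F , (λ ()) , (λ ()) , (λ ()) , (λ ()) , (λ ())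
twoOthers 0F                  2F                  = 1F , 3F , (λ ()) , (λ ()) , (λ ()) , (λ ()) , (λ ())
twoOthers 0F                  (suc (suc (suc _))) = 1F , 2F , (λ ()) , (λ ()) , (λ ()) , (λ ()) , (λ ())
twoOthers 1F                  0F                  = 2F , 3F , (λ ()) , (λ ()) , (λ ()) , (λ ()) , (λ ())
twoOthers 1F                  1F                  = 2F , 3F , (λ ()) , (λ ()) , (λ ()) , (λ ()) , (λ ())
twoOthers 1F                  2F                  = 0F , 3F , (λ ()) , (λ ()) , (λ ()) , (λ ()) , (λ ())
twoOthers 1F                  (suc (suc (suc _))) = 0F , 2F , (λ ()) , (λ ()) , (λ ()) , (λ ()) , (λ ())
twoOthers 2F                  0F                  = 1F , 3F , (λ ()) , (λ ()) , (λ ()) , (λ ()) , (λ ())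
twoOthers 2F                  1F                  = 0F , 3F , (λ ()) , (λ ()) , (λ ()) , (λ ()) , (λ ())
twoOthers 2F                  (suc (suc _))       = 0F , 1F , (λ ()) , (λ ()) , (λ ()) , (λ ()) , (λ ())
twoOthers (suc (suc (suc _))) 0F                  = 1F , 2F , (λ ()) , (λ ()) , (λ ()) , (λ ()) , (λ ())
twoOthers (suc (suc (suc _))) 1F                  = 0F , 2F , (λ ()) , (λ ()) , (λ ()) , (λ ()) , (λ ())
twoOthers (suc (suc (suc _))) (suc (suc _))       = 0F , 1F , (λ ()) , (λ ()) , (λ ()) , (λ ()) , (λ ())

cliqueCore⇒diamondCore : ∀ h (G : Graph) x y → CliqueCoreE h G x y → DiamondCoreEdge G x y
cliqueCore⇒diamondCore (diamondKt (suc (suc (suc (suc t)))) (s≤s (s≤s (s≤s (s≤s _))))) G _ _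
                       (f , clique , i , j , i≢j , refl , refl)
  with k , l , k≢i , k≢j , l≢i , l≢j , k≢l ← twoOthers i j =
  f i , f j , f k , f l ,
  ((apart i≢j , apart (≢-sym k≢i) , apart (≢-sym l≢i) , apart (≢-sym k≢j) , apart (≢-sym l≢j) , apart k≢l) ,
   clique i j i≢j , clique i k (≢-sym k≢i) , clique i l (≢-sym l≢i) ,
   clique j k (≢-sym k≢j) , clique j l (≢-sym l≢j)) ,
  inj₁ refl , inj₂ (inj₁ refl) , apart i≢j ,
  λ { (inj₁ (fi≡fk , _)) → apart (≢-sym k≢i) fi≡fk ; (inj₂ (fi≡fl , _)) → apart (≢-sym l≢i) fi≡fl }
  where
  apart : ∀ {p q} → p ≢ q → f p ≢ f q
  apart p≢q = edge-irreflexive G (clique _ _ p≢q)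

coreEdge? : ∀ h (G : Graph) x y → Dec (CoreEdge h G x y)
coreEdge? h G x y with diamondCoreEdge? G x y
... | yes diamond = yes (inj₁ diamond)
... | no ¬diamond = no λ { (inj₁ diamond) → ¬diamond diamond
                         ; (inj₂ clique)  → ¬diamond (cliqueCore⇒diamondCore h G x y clique) }

coreEdge⇒coreVertex : ∀ h (G : Graph) x y → CoreEdge h G x y → CoreVertex h G x
coreEdge⇒coreVertex h G x y (inj₁ (a , b , c , d , diamond , x∈ , _)) = inj₁ (a , b , c , d , diamond , x∈)
coreEdge⇒coreVertex (diamondKt t _) G x y (inj₂ (f , clique , i , _ , _ , fi≡x , _)) = inj₂ (f , clique , i , fi≡x)

module _ (G : Graph) {x : Fin (n G)} (isolated : ∀ y → adj G x y ≡ false) where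

  isolated-reach : ∀ {P u} → ReachIn G P x u → u ≡ x
  isolated-reach (here _) = refl
  isolated-reach (step {w = w} r vw _) with refl ← isolated-reach r with () ← trans (sym vw) (isolated w)

  isolated-noInducedMember : ∀ h → ¬ InducedMemberIn h G (Reach G x)
  isolated-noInducedMember h (inj₁ (a , b , _ , _ , ((_ , ab , _) , _) , x⇝a , _))
    with refl ← isolated-reach x⇝a with () ← trans (sym ab) (isolated b)
  isolated-noInducedMember (diamondKt (suc (suc t)) (s≤s (s≤s _))) (inj₂ (f , clique , x⇝f))
    with refl ← isolated-reach (x⇝f 0F) with () ← trans (sym (clique 0F 1F (λ ()))) (isolated (f 1F))

inducedBy : (G : Graph) {m : ℕ} → (Fin m → Fin (n G)) → Graph
inducedBy G {m} o = record
  { n     = m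
  ; adj   = λ a b → adj G (o a) (o b)
  ; sym   = λ a b → adj-sym G (o a) (o b)
  ; irref = irref G ∘ o
  }

deleteIsolated : (G : Graph) (x : Fin (n G)) → (∀ y → adj G x y ≡ false) →
                 Σ Graph (DeleteComponent G x)
deleteIsolated G@record { n = suc m } x isolated = inducedBy G (punchIn x) , record
  { o      = punchIn x
  ; o-inj  = λ _ _ → punchIn-injective x _ _
  ; o-out  = λ a x⇝ → punchInᵢ≢i x a (isolated-reach G isolated x⇝)
  ; o-surj = λ u unreached → punchOut (λ x≡u → unreached (subst (Reach G x) x≡u (here _))) , punchIn-punchOut _
  ; o-adj  = λ _ _ → refl
  }

-- The old vertices other than v are listed by an injection from Fin m; the split graph has
-- vertex set Fin (m + t), whose last t vertices stand for the components of G[N(v)], each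
-- represented by its least vertex (its root).
module Splitting (G : Graph) (v : Fin (n G)) {m : ℕ} (old : Fin m → Fin (n G))
                 (old-injective : ∀ {i i'} → old i ≡ old i' → i ≡ i')
                 (old-≢ : ∀ i → old i ≢ v)
                 (old-onto : ∀ u → u ≢ v → ∃[ i ] old i ≡ u) where

  Component : Fin (n G) → Fin (n G) → Set
  Component = ReachIn G (N G v)

  component? : ∀ c u → Dec (Component c u)
  component? = reachIn? G (adj G v)

  IsRoot : Fin (n G) → Set
  IsRoot c = N G v c × (∀ d → Component c d → toℕ c ≤ toℕ d)

  isRoot? : ∀ c → Dec (IsRoot c)
  isRoot? c = (adj G v c ≟ᵇ true) ×-dec all? (λ d → component? c d →-dec (toℕ c ≤? toℕ d))

  root-unique : ∀ {c c'} → IsRoot c → IsRoot c' → Component c c' → c ≡ c'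
  root-unique (_ , c-least) (_ , c'-least) c⇝c' =
    toℕ-injective (≤-antisym (c-least _ c⇝c') (c'-least _ (reach-sym G c⇝c')))

  rootOf : ∀ {c} → N G v c → ∃[ r ] Component c r × IsRoot r
  rootOf {c} vc with r , c⇝r , r-least ← least (component? c) (here vc) =
    r , c⇝r , reach-target G c⇝r , λ d r⇝d → r-least d (reach-trans G c⇝r r⇝d)

  t : ℕ
  t = count (n G) (does ∘ isRoot?)

  root : Fin t → Fin (n G)
  root = enumerate (n G) (does ∘ isRoot?)

  root-isRoot : ∀ j → IsRoot (root j)
  root-isRoot j = does-true (isRoot? (root j)) (enumerate-sound (n G) _ j)

  Vertex : Set
  Vertex = Fin m ⊎ Fin t

  origin : Vertex → Fin (n G)
  origin (inj₁ i) = old i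
  origin (inj₂ _) = v

  inComponent : Fin t → Fin (n G) → Bool
  inComponent j u = does (component? (root j) u)

  adjˢ : Vertex → Vertex → Bool
  adjˢ (inj₁ i) (inj₁ i') = adj G (old i) (old i')
  adjˢ (inj₁ i) (inj₂ j)  = inComponent j (old i)
  adjˢ (inj₂ j) (inj₁ i)  = inComponent j (old i)
  adjˢ (inj₂ _) (inj₂ _)  = false

  adjˢ-sym : ∀ x y → adjˢ x y ≡ adjˢ y x
  adjˢ-sym (inj₁ i) (inj₁ i') = adj-sym G (old i) (old i')
  adjˢ-sym (inj₁ _) (inj₂ _)  = refl
  adjˢ-sym (inj₂ _) (inj₁ _)  = refl
  adjˢ-sym (inj₂ _) (inj₂ _)  = refl

  adjˢ-irrefl : ∀ x → adjˢ x x ≡ false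
  adjˢ-irrefl (inj₁ i) = irref G (old i)
  adjˢ-irrefl (inj₂ _) = refl

  toVertex : Fin (m + t) → Vertex
  toVertex = splitAt m

  toVertex-injective : ∀ {a b} → toVertex a ≡ toVertex b → a ≡ b
  toVertex-injective {a} {b} eq =
    trans (sym (join-splitAt m t a)) (trans (cong (join m t) eq) (join-splitAt m t b))

  splitGraph : Graph
  splitGraph = record
    { n     = m + t
    ; adj   = λ a b → adjˢ (toVertex a) (toVertex b)
    ; sym   = λ a b → adjˢ-sym (toVertex a) (toVertex b)
    ; irref = λ a → adjˢ-irrefl (toVertex a)
    }

  origin-injective : ∀ x y → origin x ≡ origin y → origin x ≢ v → x ≡ y
  origin-injective (inj₁ i) (inj₁ i') eq _  = cong inj₁ (old-injective eq)
  origin-injective (inj₁ i) (inj₂ _)  eq _  = ⊥-elim (old-≢ i eq)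
  origin-injective (inj₂ _) _         _  ≢v = ⊥-elim (≢v refl)

  adjˢ-old : ∀ x y → origin x ≢ v → origin y ≢ v → adjˢ x y ≡ adj G (origin x) (origin y)
  adjˢ-old (inj₁ _) (inj₁ _) _  _  = refl
  adjˢ-old (inj₁ _) (inj₂ _) _  ≢v = ⊥-elim (≢v refl)
  adjˢ-old (inj₂ _) _        ≢v _  = ⊥-elim (≢v refl)

  adjˢ-new : ∀ x → origin x ≡ v → Σ (Fin (n G)) λ c → N G v c ×
             (∀ y → origin y ≢ v → (adjˢ x y ≡ true → Component c (origin y))
                                  × (Component c (origin y) → adjˢ x y ≡ true))
  adjˢ-new (inj₁ i) ≡v = ⊥-elim (old-≢ i ≡v)
  adjˢ-new (inj₂ j) _  = root j , proj₁ (root-isRoot j) , neighbour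
    where
    neighbour : ∀ y → origin y ≢ v → (adjˢ (inj₂ j) y ≡ true → Component (root j) (origin y))
                                   × (Component (root j) (origin y) → adjˢ (inj₂ j) y ≡ true)
    neighbour (inj₁ i) _  = does-true (component? (root j) (old i)) , dec-true (component? (root j) (old i))
    neighbour (inj₂ _) ≢v = ⊥-elim (≢v refl)

  adjˢ-new-new : ∀ x y → origin x ≡ v → origin y ≡ v → adjˢ x y ≡ false
  adjˢ-new-new (inj₁ i) _        ≡v _  = ⊥-elim (old-≢ i ≡v)
  adjˢ-new-new (inj₂ _) (inj₁ i) _  ≡v = ⊥-elim (old-≢ i ≡v)
  adjˢ-new-new (inj₂ _) (inj₂ _) _  _  = refl

  -- Two new vertices with a common neighbour represent the same component, hence the same root.
  adjˢ-new-distinct : ∀ x x' y → origin x ≡ v → origin x' ≡ v →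
                      adjˢ x y ≡ true → adjˢ x' y ≡ true → x ≡ x'
  adjˢ-new-distinct (inj₁ i) _         _        ≡v _   _   _ = ⊥-elim (old-≢ i ≡v)
  adjˢ-new-distinct (inj₂ _) (inj₁ i)  _        _  ≡v  _   _ = ⊥-elim (old-≢ i ≡v)
  adjˢ-new-distinct (inj₂ j) (inj₂ j') (inj₁ i) _  _   jy j'y =
    cong inj₂ (enumerate-injective (n G) _ (root-unique (root-isRoot j) (root-isRoot j')
      (reach-trans G (does-true (component? _ _) jy) (reach-sym G (does-true (component? _ _) j'y)))))

  adjˢ-cover : ∀ c → N G v c → ∃[ x ] ∃[ y ] origin x ≡ v × origin y ≡ c × adjˢ x y ≡ true
  adjˢ-cover c vc with r , c⇝r , r-root ← rootOf vc
                  with i , old-i≡c ← old-onto c (≢-sym (edge-irreflexive G vc)) =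
    inj₂ j , inj₁ i , refl , old-i≡c ,
    dec-true (component? (root j) (old i))
      (subst₂ Component (sym (enumerate-position (n G) _ r r-isRoot)) (sym old-i≡c) (reach-sym G c⇝r))
    where
    r-isRoot : does (isRoot? r) ≡ true
    r-isRoot = dec-true (isRoot? r) r-root
    j : Fin t
    j = position (n G) (does ∘ isRoot?) r r-isRoot

  splitting : (∃[ c ] ∃[ d ] N G v c × N G v d × ¬ Component c d) → VertexSplit G v splitGraph
  splitting disconnected = record
    { o        = origin ∘ toVertex
    ; o-inj    = λ a b eq ≢v → toVertex-injective (origin-injective (toVertex a) (toVertex b) eq ≢v)
    ; o-surj   = λ u u≢v → let i , old-i≡u = old-onto u u≢v
                           in join m t (inj₁ i) , trans (cong origin (splitAt-join m t (inj₁ i))) old-i≡u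
    ; old-adj  = λ a b → adjˢ-old (toVertex a) (toVertex b)
    ; new-adj  = λ a ≡v → let c , vc , nbhd = adjˢ-new (toVertex a) ≡v
                          in c , vc , λ b → nbhd (toVertex b)
    ; new-new  = λ a b → adjˢ-new-new (toVertex a) (toVertex b)
    ; new-dist = λ a a' b ≡v ≡v' ab a'b →
                   toVertex-injective
                     (adjˢ-new-distinct (toVertex a) (toVertex a') (toVertex b) ≡v ≡v' ab a'b)
    ; new-cov  = λ c vc → let x , y , ≡v , ≡c , xy = adjˢ-cover c vc
                          in join m t x , join m t y ,
                             trans (cong origin (splitAt-join m t x)) ≡v ,
                             trans (cong origin (splitAt-join m t y)) ≡c ,
                             subst₂ (λ x′ y′ → adjˢ x′ y′ ≡ true)
                                    (sym (splitAt-join m t x)) (sym (splitAt-join m t y)) xy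
    ; disconn  = disconnected
    }

vertexSplit-exists : (G : Graph) (v : Fin (n G)) →
                     (∃[ c ] ∃[ d ] N G v c × N G v d × ¬ ReachIn G (N G v) c d) →
                     Σ Graph (VertexSplit G v)
vertexSplit-exists G@record { n = suc m } v disconnected = splitGraph , splitting disconnected
  where
  open Splitting G v (punchIn v) (punchIn-injective v _ _) (punchInᵢ≢i v)
                 (λ u u≢v → punchOut (≢-sym u≢v) , punchIn-punchOut _)

removeEdge-embedding : (G : Graph) (x y : Fin (n G)) → EdgeEmbedding (removeEdge G x y) G
removeEdge-embedding G x y = record
  { map       = λ a → a
  ; preserve  = λ a b ab → proj₁ (∧-≡-true {adj G a b} ab)
  ; injective = λ _ _ _ _ _ _ a≡a' b≡b' → a≡a' , b≡b'
  }

deleteComponent-embedding : ∀ {G c G'} → DeleteComponent G c G' → EdgeEmbedding G' G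
deleteComponent-embedding {G} {c} {G'} D = record
  { map       = o
  ; preserve  = λ a b ab → trans (sym (o-adj a b)) ab
  ; injective = λ a b a' b' _ _ oa≡oa' ob≡ob' → o-inj a a' oa≡oa' , o-inj b b' ob≡ob'
  }
  where open DeleteComponent D

vertexSplit-embedding : ∀ {G v G'} → VertexSplit G v G' → EdgeEmbedding G' G
vertexSplit-embedding {G} {v} {G'} S = record { map = o ; preserve = preserve ; injective = injective }
  where
  open VertexSplit S
  new-old : ∀ a b → o a ≡ v → o b ≢ v → Edge G' a b → Edge G (o a) (o b)
  new-old a b oa≡v ob≢v ab with c , _ , nbhd ← new-adj a oa≡v =
    subst (λ u → Edge G u (o b)) (sym oa≡v) (reach-target G (proj₁ (nbhd b ob≢v) ab))
  preserve : ∀ a b → Edge G' a b → Edge G (o a) (o b)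
  preserve a b ab with o a ≟ v | o b ≟ v
  ... | no oa≢v  | no ob≢v  = trans (sym (old-adj a b oa≢v ob≢v)) ab
  ... | yes oa≡v | no ob≢v  = new-old a b oa≡v ob≢v ab
  ... | no oa≢v  | yes ob≡v =
    trans (adj-sym G (o a) (o b)) (new-old b a ob≡v oa≢v (trans (adj-sym G' b a) ab))
  ... | yes oa≡v | yes ob≡v with () ← trans (sym ab) (new-new a b oa≡v ob≡v)
  injective : ∀ a b a' b' → Edge G' a b → Edge G' a' b' → o a ≡ o a' → o b ≡ o b' → a ≡ a' × b ≡ b'
  injective a b a' b' ab a'b' oa≡oa' ob≡ob' with o a ≟ v | o b ≟ v
  ... | yes oa≡v | yes ob≡v with () ← trans (sym ab) (new-new a b oa≡v ob≡v)
  ... | no oa≢v  | yes ob≡v with refl ← o-inj a a' oa≡oa' oa≢v =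
    refl , new-dist b b' a ob≡v (trans (sym ob≡ob') ob≡v)
                    (trans (adj-sym G' b a) ab) (trans (adj-sym G' b' a) a'b')
  ... | yes oa≡v | no ob≢v  with refl ← o-inj b b' ob≡ob' ob≢v =
    new-dist a a' b oa≡v (trans (sym oa≡oa') oa≡v) ab a'b' , refl
  ... | no oa≢v  | no ob≢v  = o-inj a a' oa≡oa' oa≢v , o-inj b b' ob≡ob' ob≢v

step-embedding : ∀ {h I J} → Step h I J → EdgeEmbedding (proj₁ J) (proj₁ I)
step-embedding (irrelevantEdge x y _ _) = removeEdge-embedding _ x y
step-embedding (sunflower x y _ _ _ _)  = removeEdge-embedding _ x y
step-embedding (vertexSplit _ _ S)      = vertexSplit-embedding S
step-embedding (irrelevantComp _ _ _ D) = deleteComponent-embedding D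

steps-edges-mono : ∀ {h I J} → Star (Step h) I J → edges (proj₁ J) ≤ edges (proj₁ I)
steps-edges-mono ε        = ≤-refl
steps-edges-mono (s ◅ ss) = ≤-trans (steps-edges-mono ss) (edges-mono (step-embedding s))

module _ {h : Family} {G : Graph} {k : ℤ} (irreducible : Irreducible h (G , k)) where

  irreducible⇒coreEdge : ∀ x y → Edge G x y → CoreEdge h G x y
  irreducible⇒coreEdge x y xy with coreEdge? h G x y
  ... | yes core = core
  ... | no ¬core = ⊥-elim (irreducible _ (irrelevantEdge x y xy ¬core))

  irreducible⇒neighbour : ∀ x → ∃[ y ] Edge G x y
  irreducible⇒neighbour x with any? (λ y → adj G x y ≟ᵇ true)
  ... | yes neighbour = neighbour
  ... | no ¬neighbour =
    let isolated y = ¬-not (λ xy → ¬neighbour (y , xy))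
        G′ , deletion = deleteIsolated G x isolated
    in ⊥-elim (irreducible _ (irrelevantComp x G′ (isolated-noInducedMember G isolated h) deletion))

  irreducible⇒coreVertex : ∀ x → CoreVertex h G x
  irreducible⇒coreVertex x =
    let y , xy = irreducible⇒neighbour x in coreEdge⇒coreVertex h G x y (irreducible⇒coreEdge x y xy)

  irreducible⇒connectedNbhd : ConnectedNbhd G
  irreducible⇒connectedNbhd v a b va vb with reachIn? G (adj G v) a b
  ... | yes a⇝b = a⇝b
  ... | no ¬a⇝b =
    let G′ , splitting = vertexSplit-exists G v (a , b , va , vb , ¬a⇝b)
    in ⊥-elim (irreducible _ (vertexSplit v G′ splitting))

  irreducible⇒vertices≤2*edges : n G ≤ 2 * edges G
  irreducible⇒vertices≤2*edges =
    subst (n G ≤_) (degreeSum≡2*edges G) (n≤degreeSum G irreducible⇒neighbour)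

lemma5 : (h : Family) (G : Graph) (k : ℕ) (G' : Graph) (k' : ℤ) →
         Phase1 h (G , + k) (G' , k') →
         ((∀ x → CoreVertex h G' x) × (∀ x y → Edge G' x y → CoreEdge h G' x y))
         × ConnectedNbhd G'
         × edges G' ≤ edges G
         × n G' ≤ 2 * edges G
lemma5 h G k G' k' (steps , irreducible) =
  (irreducible⇒coreVertex irreducible , irreducible⇒coreEdge irreducible) ,
  irreducible⇒connectedNbhd irreducible ,
  edges-decrease ,
  ≤-trans (irreducible⇒vertices≤2*edges irreducible) (*-monoʳ-≤ 2 edges-decrease)
  where
  edges-decrease : edges G' ≤ edges G
  edges-decrease = steps-edges-mono steps
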